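{- For each $n\ge 1$ there exists a Boolean network $f$ whose interaction graph $G(f)$ admits a path of length $n$ all of whose vertices have indegree one and outdegree one in $G(f)$, such that the network $\tilde f$ obtained from $f$ by eliminating any one of the variables in this path satisfies $A(\tilde f)>A(f)$.
   Context: $\mathbb{B}=\{0,1\}$. A Boolean network is a map $f\colon\mathbb{B}^n\to\mathbb{B}^n$ with components $V$. $\bar{x}^i$ denotes $x$ with component $i$ flipped; $x^{i=a}$ denotes $x$ with component $i$ set to $a$. The asynchronous dynamics $AD(f)$ is the directed graph on the states with a transition $x\to\bar{x}^i$ iff $f_i(x)\neq x_i$. The interaction graph $G(f)$ is the signed multidigraph on $V$ with an edge $j\to i$ of sign $s\in\{ -1,1\}$ iff $s=(f_i(\bar{x}^j)-f_i(x))(\bar{x}^j_j-x_j)$ for some state $x$; indegree/outdegree are counted in $G(f)$. A trap set is a set of states closed under transitions; attractors are minimal nonempty trap sets; an attractor is a fixed point if it has one state and cyclic otherwise. $S(f)$ denotes the number of fixed points and $A(f)$ the number of cyclic attractors of $AD(f)$. Elimination of a variable $v$ with no positive loop at $v$ in $G(f)$: for $a\in\{0,1\}$, $\mathcal{R}^a(x)$ is $x$ with component $v$ replaced by $f_v(x^{v=a})$; $\pi$ is the projection onto the components $V\setminus\{v\}$; $\mathcal{S}^a$ is the unique map with $\mathcal{S}^a\circ\pi=\mathcal{R}^a$; $\tilde f_i(x)=f_i(\mathcal{S}^0(x))\wedge f_i(\mathcal{S}^1(x))$ if $x_i=1$ and $\tilde f_i(x)=f_i(\mathcal{S}^0(x))\vee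 f_i(\mathcal{S}^1(x))$ if $x_i=0$, for $i\neq v$. (A vertex with indegree one whose unique regulator is another vertex has no loop, so it can be eliminated; then $\tilde f$ is obtained by substituting $f_v$ for $x_v$.) -}

module Defs where

open import Data.Bool using (Bool; true; false; not; _∧_; _∨_; if_then_else_)
open import Data.Nat using (ℕ; suc; _<_)
open import Data.Fin using (Fin; punchIn; inject₁) renaming (suc to fsuc)
open import Data.Vec using (Vec; lookup; insertAt; tabulate; _[_]%=_)
open import Data.Integer using (ℤ; +_; -[1+_]; _-_; _*_)
open import Data.Product using (Σ; ∃; ∃₂; _×_; _,_)
open import Relation.Binary.PropositionalEquality using (_≡_; _≢_)
open import Relation.Nullary using (¬_)

State : ℕ → Set
State m = Vec Bool m

BN : ℕ → Set
BN m = State m → State m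

comp : ∀ {m} → BN m → Fin m → State m → Bool
comp f i x = lookup (f x) i

flipAt : ∀ {m} → State m → Fin m → State m
flipAt x i = x [ i ]%= not

Trans : ∀ {m} → BN m → State m → State m → Set
Trans f x y = ∃ λ i → (comp f i x ≢ lookup x i) × (y ≡ flipAt x i)

StateSet : ℕ → Set
StateSet m = State m → Bool

_⊆ₛ_ : ∀ {m} → StateSet m → StateSet m → Set
S ⊆ₛ T = ∀ x → S x ≡ true → T x ≡ true

SameSet : ∀ {m} → StateSet m → StateSet m → Set
SameSet S T = ∀ x → S x ≡ T x

NonEmpty : ∀ {m} → StateSet m → Set
NonEmpty S = ∃ λ x → S x ≡ true

TrapSet : ∀ {m} → BN m → StateSet m → Set
TrapSet f S = ∀ x y → S x ≡ true → Trans f x y → S y ≡ true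

Attractor : ∀ {m} → BN m → StateSet m → Set
Attractor f S = TrapSet f S × NonEmpty S ×
  (∀ T → TrapSet f T → NonEmpty T → T ⊆ₛ S → S ⊆ₛ T)

CyclicAttractor : ∀ {m} → BN m → StateSet m → Set
CyclicAttractor f S = Attractor f S ×
  (∃₂ λ x y → x ≢ y × S x ≡ true × S y ≡ true)

-- A(f) = k : there are exactly k cyclic attractors (as sets of states)
NumCyclicAttractors : ∀ {m} → BN m → ℕ → Set
NumCyclicAttractors {m} f k = Σ (Vec (StateSet m) k) λ As →
  (∀ i → CyclicAttractor f (lookup As i)) ×
  (∀ i j → SameSet (lookup As i) (lookup As j) → i ≡ j) ×
  (∀ S → CyclicAttractor f S → ∃ λ i → SameSet S (lookup As i))

data Sign : Set where
  plus minus : Sign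

⟦_⟧ : Sign → ℤ
⟦ plus ⟧ = + 1
⟦ minus ⟧ = -[1+ 0 ]

toℤ : Bool → ℤ
toℤ false = + 0
toℤ true = + 1

Edge : ∀ {m} → BN m → Fin m → Fin m → Sign → Set
Edge f j i s = ∃ λ x →
  ⟦ s ⟧ ≡ (toℤ (comp f i (flipAt x j)) - toℤ (comp f i x))
          * (toℤ (lookup (flipAt x j) j) - toℤ (lookup x j))

-- indegree one in the signed multidigraph G(f): exactly one (regulator, sign) pair
InDegreeOne : ∀ {m} → BN m → Fin m → Set
InDegreeOne f i = ∃₂ λ j s → Edge f j i s ×
  (∀ j' s' → Edge f j' i s' → (j' ≡ j) × (s' ≡ s))

OutDegreeOne : ∀ {m} → BN m → Fin m → Set
OutDegreeOne f j = ∃₂ λ i s → Edge f j i s ×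
  (∀ i' s' → Edge f j i' s' → (i' ≡ i) × (s' ≡ s))

IsPath : ∀ {m} → BN m → (n : ℕ) → (Fin (suc n) → Fin m) → Set
IsPath f n p = (∀ k → ∃ λ s → Edge f (p (inject₁ k)) (p (fsuc k)) s) ×
               (∀ k l → p k ≡ p l → k ≡ l)

-- Elimination of variable v (meaningful when there is no positive loop at v)

NoPositiveLoop : ∀ {m} → BN m → Fin m → Set
NoPositiveLoop f v = ¬ Edge f v v plus

-- S^a(y) = R^a(x) for any x with π(x) = y, where
-- R^a(x) = x with component v replaced by f_v(x^{v=a})
liftS : ∀ {m} → BN (suc m) → Fin (suc m) → Bool → State m → State (suc m)
liftS f v a y = insertAt y v (comp f v (insertAt y v a))

-- f̃ on components V ∖ {v}; component i of f̃ corresponds to component punchIn v i of f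
eliminate : ∀ {m} → BN (suc m) → Fin (suc m) → BN m
eliminate f v y = tabulate λ i →
  let g = λ a → comp f (punchIn v i) (liftS f v a y) in
  if lookup y i then g false ∧ g true else g false ∨ g true

{-# OPTIONS --safe #-}
-- The network has a latch e, an oscillator u and a shift register c fed by u, split into a
-- prefix of L cells and a tail of M + 1 cells.  While e is off, u toggles whenever the tail is
-- constant, and e switches on for good once the tail shows M changes of value.  Shifting never
-- increases the number of changes along u c, and a toggle of u with a constant tail leaves at
-- most L + 1 of them.  Hence for M = L + 2 the unlatched states with at most L + 1 changes form
-- a strongly connected trap set, the only cyclic attractor, whereas for M = L + 1 one can pump
-- L + 1 changes into the register and shift them into the tail, so that the latch fires and
-- every state runs into a fixed point.  The prefix cells form a path of copy vertices, and
-- eliminating one of them yields the same network with a prefix shorter by one: the case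
-- M = L + 1 turns into the case M = L + 2.
module Submission where

open import Defs
open import Data.Bool using (Bool; true; false; not; _∧_; _∨_; if_then_else_)
open import Data.Bool.Properties using (∧-idem; ∨-idem; not-¬; not-involutive; ⇔→≡) renaming (_≟_ to _≟ᵇ_)
open import Data.Empty using (⊥; ⊥-elim)
open import Data.Fin using (Fin; _↑ˡ_; inject₁; punchIn; toℕ) renaming (zero to fzero; suc to fsuc; _≟_ to _≟ᶠ_)
open import Data.Fin.Properties using (inject₁-injective; suc-injective; ↑ˡ-injective; toℕ-inject₁)
open import Data.Integer using (+_; _-_; _*_)
open import Data.Integer.Properties using (+-inverseʳ)
open import Data.Nat using (ℕ; zero; suc; _+_; _≤_; _<_; z≤n; s≤s; s≤s⁻¹; _≟_; _≤?_)
open import Data.Nat.Properties using (≤-refl; ≤-trans; ≤-reflexive; +-monoˡ-≤; +-monoʳ-≤; +-mono-≤; m≤n+m; n≤1+n; 1+n≢n; 1+n≰n)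
open import Data.Product using (Σ; ∃; ∃₂; _×_; _,_; proj₁; map₁)
open import Data.Sum using (_⊎_; inj₁; inj₂)
open import Data.Vec using (Vec; []; _∷_; _++_; lookup; replicate; drop; insertAt; updateAt; tabulate)
open import Data.Vec.Properties using (≡-dec; lookup∘updateAt; lookup∘updateAt′; tabulate∘lookup; tabulate-cong)
open import Function using (_∘_)
open import Function.Bundles using (mk⇔)
open import Relation.Binary.Construct.Closure.ReflexiveTransitive using (Star; ε; _◅_; _◅◅_; gmap)
open import Relation.Binary.PropositionalEquality using (_≡_; _≢_; _≗_; refl; sym; trans; cong; cong₂; subst)
open import Relation.Nullary using (¬_; Dec; yes; no; does)
open import Relation.Nullary.Decidable using (dec-true; dec-false; decidable-stable)

does≡true⇒ : ∀ {P : Set} (p? : Dec P) → does p? ≡ true → P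
does≡true⇒ (yes p) _ = p
does≡true⇒ (no _) ()

-- Interaction graph

flipAt-self : ∀ {m} (x : State m) i → lookup (flipAt x i) i ≡ not (lookup x i)
flipAt-self x i = lookup∘updateAt i x

flipAt-other : ∀ {m} (x : State m) {i j} → j ≢ i → lookup (flipAt x i) j ≡ lookup x j
flipAt-other x {i} {j} j≢i = lookup∘updateAt′ j i j≢i x

private
  flip-weight² : ∀ b → (toℤ (not b) - toℤ b) * (toℤ (not b) - toℤ b) ≡ + 1
  flip-weight² true = refl
  flip-weight² false = refl

  ⟦⟧≢0 : ∀ s → ⟦ s ⟧ ≢ + 0
  ⟦⟧≢0 plus ()
  ⟦⟧≢0 minus ()

  ⟦⟧≡1⇒plus : ∀ s → ⟦ s ⟧ ≡ + 1 → s ≡ plus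
  ⟦⟧≡1⇒plus plus _ = refl

module _ {m} (f : BN m) where

  independent⇒¬Edge : ∀ {i j} → (∀ x → comp f i (flipAt x j) ≡ comp f i x) → ∀ s → ¬ Edge f j i s
  independent⇒¬Edge {i} {j} independent s (x , s≡weight) = ⟦⟧≢0 s (trans s≡weight weight≡0)
    where
    weight≡0 : (toℤ (comp f i (flipAt x j)) - toℤ (comp f i x))
               * (toℤ (lookup (flipAt x j) j) - toℤ (lookup x j)) ≡ + 0
    weight≡0 rewrite independent x = cong (_* _) (+-inverseʳ (toℤ (comp f i x)))

  module _ {i j} (copies : ∀ x → comp f i x ≡ lookup x j) where

    private
      weight≡1 : ∀ x → (toℤ (comp f i (flipAt x j)) - toℤ (comp f i x))
                       * (toℤ (lookup (flipAt x j) j) - toℤ (lookup x j)) ≡ + 1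
      weight≡1 x rewrite copies (flipAt x j) | copies x | flipAt-self x j = flip-weight² (lookup x j)

    copy⇒Edge : Edge f j i plus
    copy⇒Edge = replicate m false , sym (weight≡1 _)

    copy⇒Edge-unique : ∀ {j′ s} → Edge f j′ i s → j′ ≡ j × s ≡ plus
    copy⇒Edge-unique {j′} {s} edge@(x , s≡weight) with j′ ≟ᶠ j
    ... | yes refl = refl , ⟦⟧≡1⇒plus s (trans s≡weight (weight≡1 x))
    ... | no j′≢j = ⊥-elim (independent⇒¬Edge unaffected s edge)
      where
      unaffected : ∀ y → comp f i (flipAt y j′) ≡ comp f i y
      unaffected y = trans (copies _) (trans (flipAt-other y (j′≢j ∘ sym)) (sym (copies y)))

    copy⇒InDegreeOne : InDegreeOne f i
    copy⇒InDegreeOne = j , plus , copy⇒Edge , λ _ _ → copy⇒Edge-unique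

-- Counting cyclic attractors

module _ {m} (f : BN m) where

  Reach : State m → State m → Set
  Reach = Star (Trans f)

  FixedPoint : State m → Set
  FixedPoint z = ∀ y → ¬ Trans f z y

  trap-reach : ∀ {S x y} → TrapSet f S → S x ≡ true → Reach x y → S y ≡ true
  trap-reach trap Sx ε = Sx
  trap-reach trap Sx (t ◅ r) = trap-reach trap (trap _ _ Sx t) r

  private
    singleton : State m → StateSet m
    singleton z y = does (≡-dec _≟ᵇ_ y z)

    singleton-sound : ∀ {z y} → singleton z y ≡ true → y ≡ z
    singleton-sound {z} {y} = does≡true⇒ (≡-dec _≟ᵇ_ y z)

    singleton-trap : ∀ {z} → FixedPoint z → TrapSet f (singleton z)
    singleton-trap fixed x y x∈z t = ⊥-elim (fixed y (subst (λ w → Trans f w y) (singleton-sound x∈z) t))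

  cyclic-attractor-avoids-fixed-points :
    ∀ {S x z} → CyclicAttractor f S → S x ≡ true → FixedPoint z → Reach x z → ⊥
  cyclic-attractor-avoids-fixed-points {S} {z = z} ((trap , _ , minimal) , (y₁ , y₂ , y₁≢y₂ , Sy₁ , Sy₂))
                                       Sx fixed r =
    y₁≢y₂ (trans (collapse Sy₁) (sym (collapse Sy₂)))
    where
    z⊆S : singleton z ⊆ₛ S
    z⊆S w w∈z = subst (λ v → S v ≡ true) (sym (singleton-sound w∈z)) (trap-reach trap Sx r)

    collapse : ∀ {y} → S y ≡ true → y ≡ z
    collapse {y} Sy =
      singleton-sound (minimal (singleton z) (singleton-trap fixed) (z , dec-true (≡-dec _≟ᵇ_ z z) refl) z⊆S y Sy)

  no-cyclic-attractor : (∀ x → ∃ λ z → FixedPoint z × Reach x z) → NumCyclicAttractors f 0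
  no-cyclic-attractor escape = [] , (λ ()) , (λ ()) , λ S cyclic → ⊥-elim (impossible S cyclic)
    where
    impossible : ∀ S → CyclicAttractor f S → ⊥
    impossible S cyclic@((_ , (x , Sx) , _) , _) =
      let z , fixed , r = escape x in cyclic-attractor-avoids-fixed-points cyclic Sx fixed r

  unique-cyclic-attractor : (C : StateSet m) → TrapSet f C →
    (∃₂ λ x y → x ≢ y × C x ≡ true × C y ≡ true) →
    (∀ {x y} → C x ≡ true → C y ≡ true → Reach x y) →
    (∀ x → (∃ λ z → FixedPoint z × Reach x z) ⊎ (∃ λ c → C c ≡ true × Reach x c)) →
    NumCyclicAttractors f 1
  unique-cyclic-attractor C trap two@(x , _ , _ , Cx , _) connected escape =
    C ∷ [] , (λ { fzero → C-cyclic }) , (λ { fzero fzero _ → refl }) , λ S cyclic → fzero , same S cyclic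
    where
    C-cyclic : CyclicAttractor f C
    C-cyclic = (trap , (x , Cx) , λ T T-trap (t , Tt) T⊆C w Cw → trap-reach T-trap Tt (connected (T⊆C t Tt) Cw)) , two

    same : ∀ S → CyclicAttractor f S → SameSet S C
    same S cyclic@((S-trap , (s , Ss) , S-minimal) , _) with escape s
    ... | inj₁ (z , fixed , r) = ⊥-elim (cyclic-attractor-avoids-fixed-points cyclic Ss fixed r)
    ... | inj₂ (c , Cc , r) = λ w → ⇔→≡ (mk⇔ (S-minimal C trap (c , Cc) C⊆S w) (C⊆S w))
      where
      C⊆S : C ⊆ₛ S
      C⊆S w Cw = trap-reach S-trap (trap-reach S-trap Ss r) (connected Cc Cw)

Trans-resp-≗ : ∀ {m} {f g : BN m} → f ≗ g → ∀ {x y} → Trans f x y → Trans g x y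
Trans-resp-≗ f≗g {x} (i , moves , y≡) = i , moves ∘ trans (cong (λ v → lookup v i) (f≗g x)) , y≡

TrapSet-resp-≗ : ∀ {m} {f g : BN m} → f ≗ g → ∀ {S} → TrapSet g S → TrapSet f S
TrapSet-resp-≗ f≗g trap x y Sx t = trap x y Sx (Trans-resp-≗ f≗g t)

Attractor-resp-≗ : ∀ {m} {f g : BN m} → f ≗ g → ∀ {S} → Attractor f S → Attractor g S
Attractor-resp-≗ f≗g (trap , nonempty , minimal) =
  TrapSet-resp-≗ (sym ∘ f≗g) trap , nonempty , λ T T-trap → minimal T (TrapSet-resp-≗ f≗g T-trap)

NumCyclicAttractors-resp-≗ : ∀ {m} {f g : BN m} → f ≗ g → ∀ {k} → NumCyclicAttractors f k → NumCyclicAttractors g k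
NumCyclicAttractors-resp-≗ f≗g (As , cyclic , distinct , complete) =
  As , map₁ (Attractor-resp-≗ f≗g) ∘ cyclic , distinct ,
  λ S → complete S ∘ map₁ (Attractor-resp-≗ (sym ∘ f≗g))

-- Elimination of a variable

substitute : ∀ {m} → BN (suc m) → Fin (suc m) → BN m
substitute f v y = tabulate λ i → comp f (punchIn v i) (liftS f v false y)

eliminate≗substitute : ∀ {m} (f : BN (suc m)) v →
  (∀ y a → comp f v (insertAt y v a) ≡ comp f v (insertAt y v false)) →
  eliminate f v ≗ substitute f v
eliminate≗substitute f v self-independent y = tabulate-cong λ i →
  trans (cong (λ c → if lookup y i then g i false ∧ c else g i false ∨ c)
              (cong (comp f (punchIn v i) ∘ insertAt y v) (self-independent y true)))
        (combine-idem (lookup y i) (g i false))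
  where
  g : Fin _ → Bool → Bool
  g i a = comp f (punchIn v i) (liftS f v a y)

  combine-idem : ∀ b c → (if b then c ∧ c else c ∨ c) ≡ c
  combine-idem true = ∧-idem
  combine-idem false = ∨-idem

inject₁-↑ˡ : ∀ {m} n (i : Fin m) → inject₁ (i ↑ˡ n) ≡ inject₁ i ↑ˡ n
inject₁-↑ˡ n fzero = refl
inject₁-↑ˡ n (fsuc i) = cong fsuc (inject₁-↑ˡ n i)

suc≢inject₁ : ∀ {n} (i : Fin n) → fsuc i ≢ inject₁ i
suc≢inject₁ i eq = 1+n≢n (trans (cong toℕ eq) (toℕ-inject₁ i))

next : ∀ {m n} → Fin m → Fin (m + suc n)
next {suc zero} fzero = fsuc fzero
next {suc (suc m)} fzero = fsuc fzero
next {suc (suc m)} (fsuc i) = fsuc (next i)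

inject₁-next : ∀ {m n} (i : Fin m) → inject₁ (next {m} {n} i) ≡ fsuc (i ↑ˡ suc n)
inject₁-next {suc zero} fzero = refl
inject₁-next {suc (suc m)} fzero = refl
inject₁-next {suc (suc m)} (fsuc i) = cong fsuc (inject₁-next i)

drop-++ : ∀ {A : Set} {m n} (xs : Vec A m) (ys : Vec A n) → drop m (xs ++ ys) ≡ ys
drop-++ [] ys = refl
drop-++ (x ∷ xs) ys = drop-++ xs ys

drop-updateAt-↑ˡ : ∀ {A : Set} m {n} (i : Fin m) (xs : Vec A (m + n)) {f : A → A} →
  drop m (updateAt xs (i ↑ˡ n) f) ≡ drop m xs
drop-updateAt-↑ˡ (suc m) fzero (x ∷ xs) = refl
drop-updateAt-↑ˡ (suc m) (fsuc i) (x ∷ xs) = drop-updateAt-↑ˡ m i xs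

drop-insertAt-↑ˡ : ∀ {A : Set} m {n} (i : Fin (suc m)) (xs : Vec A (m + n)) a →
  drop (suc m) (insertAt xs (i ↑ˡ n) a) ≡ drop m xs
drop-insertAt-↑ˡ m fzero xs a = refl
drop-insertAt-↑ˡ (suc m) (fsuc i) (x ∷ xs) a = drop-insertAt-↑ˡ m i xs a

-- Shift registers

differ : Bool → Bool → ℕ
differ false false = 0
differ false true = 1
differ true false = 1
differ true true = 0

changesFrom : ∀ {k} → Bool → Vec Bool k → ℕ
changesFrom a [] = 0
changesFrom a (x ∷ xs) = differ a x + changesFrom x xs

changes : ∀ {k} → Vec Bool k → ℕ
changes [] = 0
changes (x ∷ xs) = changesFrom x xs

shiftIn : ∀ {k} → Bool → Vec Bool k → Vec Bool k
shiftIn a [] = []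
shiftIn a (x ∷ xs) = a ∷ shiftIn x xs

zigzag : ∀ {k} → Bool → ℕ → Vec Bool k
zigzag a zero = replicate _ a
zigzag {zero} a (suc j) = []
zigzag {suc k} a (suc j) = not a ∷ zigzag (not a) j

differ-self : ∀ a → differ a a ≡ 0
differ-self false = refl
differ-self true = refl

differ-not : ∀ a → differ a (not a) ≡ 1
differ-not false = refl
differ-not true = refl

differ≤1 : ∀ a b → differ a b ≤ 1
differ≤1 false false = z≤n
differ≤1 false true = ≤-refl
differ≤1 true false = ≤-refl
differ≤1 true true = z≤n

changesFrom-replicate : ∀ {k} a → changesFrom a (replicate k a) ≡ 0
changesFrom-replicate {zero} a = refl
changesFrom-replicate {suc k} a = cong₂ _+_ (differ-self a) (changesFrom-replicate {k} a)

changesFrom-replicate-++ : ∀ {n} m a (v : Vec Bool n) → changesFrom a (replicate m a ++ v) ≡ changesFrom a v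
changesFrom-replicate-++ zero a v = refl
changesFrom-replicate-++ (suc m) a v = cong₂ _+_ (differ-self a) (changesFrom-replicate-++ m a v)

changesFrom-zigzag : ∀ k a → changesFrom a (zigzag {k} a k) ≡ k
changesFrom-zigzag zero a = refl
changesFrom-zigzag (suc k) a = cong₂ _+_ (differ-not a) (changesFrom-zigzag k (not a))

changesFrom-≤-suc : ∀ {k} a b (xs : Vec Bool k) → changesFrom a xs ≤ suc (changesFrom b xs)
changesFrom-≤-suc a b [] = z≤n
changesFrom-≤-suc a b (x ∷ xs) =
  ≤-trans (+-monoˡ-≤ (changesFrom x xs) (differ≤1 a x)) (s≤s (m≤n+m (changesFrom x xs) (differ b x)))

changes-drop≤changesFrom : ∀ m {n} a (xs : Vec Bool (m + n)) → changes (drop m xs) ≤ changesFrom a xs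
changes-drop≤changesFrom zero a [] = z≤n
changes-drop≤changesFrom zero a (x ∷ xs) = m≤n+m (changesFrom x xs) (differ a x)
changes-drop≤changesFrom (suc m) a (x ∷ xs) =
  ≤-trans (changes-drop≤changesFrom m x xs) (m≤n+m (changesFrom x xs) (differ a x))

changesFrom≤1+prefix : ∀ m {n} a (xs : Vec Bool (m + suc n)) → changes (drop m xs) ≡ 0 → changesFrom a xs ≤ suc m
changesFrom≤1+prefix zero a (x ∷ xs) quiet = +-mono-≤ (differ≤1 a x) (≤-reflexive quiet)
changesFrom≤1+prefix (suc m) a (x ∷ xs) quiet = +-mono-≤ (differ≤1 a x) (changesFrom≤1+prefix m x xs quiet)

changes-drop-zigzag : ∀ m {n} a {k} → k ≤ suc m → changes (drop m (zigzag {m + suc n} a k)) ≡ 0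
changes-drop-zigzag zero {n} a {zero} _ = changesFrom-replicate {n} a
changes-drop-zigzag zero {n} a {suc zero} _ = changesFrom-replicate {n} (not a)
changes-drop-zigzag zero a {suc (suc k)} (s≤s ())
changes-drop-zigzag (suc m) a {zero} _ = changes-drop-zigzag m a z≤n
changes-drop-zigzag (suc m) a {suc k} k≤1+m = changes-drop-zigzag m (not a) (s≤s⁻¹ k≤1+m)

shiftIn-replicate : ∀ {k} a → shiftIn a (replicate k a) ≡ replicate k a
shiftIn-replicate {zero} a = refl
shiftIn-replicate {suc k} a = cong (a ∷_) (shiftIn-replicate a)

shiftIn-zigzag : ∀ {k} a j → shiftIn (not a) (zigzag {k} (not a) j) ≡ zigzag a (suc j)
shiftIn-zigzag {zero} a zero = refl
shiftIn-zigzag {zero} a (suc j) = refl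
shiftIn-zigzag {suc k} a zero = cong (not a ∷_) (shiftIn-replicate (not a))
shiftIn-zigzag {suc k} a (suc j) = cong (not a ∷_) (shiftIn-zigzag (not a) j)

lookup-shiftIn : ∀ {k} u (xs : Vec Bool k) i → lookup (shiftIn u xs) i ≡ lookup (u ∷ xs) (inject₁ i)
lookup-shiftIn u (x ∷ xs) fzero = refl
lookup-shiftIn u (x ∷ xs) (fsuc i) = lookup-shiftIn x xs i

lookup-shiftIn-insertAt : ∀ {k} u (xs : Vec Bool k) q a → lookup (shiftIn u (insertAt xs q a)) q ≡ lookup (u ∷ xs) q
lookup-shiftIn-insertAt u xs fzero a = refl
lookup-shiftIn-insertAt u (x ∷ xs) (fsuc q) a = lookup-shiftIn-insertAt x xs q a

lookup-shiftIn-insertAt-punchIn : ∀ {k} u (xs : Vec Bool k) q i →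
  lookup (shiftIn u (insertAt xs q (lookup (u ∷ xs) q))) (punchIn q i) ≡ lookup (shiftIn u xs) i
lookup-shiftIn-insertAt-punchIn u xs fzero i = refl
lookup-shiftIn-insertAt-punchIn u (x ∷ xs) (fsuc q) fzero = refl
lookup-shiftIn-insertAt-punchIn u (x ∷ xs) (fsuc q) (fsuc i) = lookup-shiftIn-insertAt-punchIn x xs q i

extend : ∀ {k a x} {xs ys : Vec Bool k} → Reach (shiftIn x) xs ys → Reach (shiftIn a) (x ∷ xs) (x ∷ ys)
extend {x = x} = gmap (x ∷_) λ (i , moves , eq) → fsuc i , moves , cong (x ∷_) eq

load-head : ∀ {k} a x (xs : Vec Bool k) → Reach (shiftIn a) (x ∷ xs) (a ∷ xs)
load-head false false xs = ε
load-head false true xs = (fzero , (λ ()) , refl) ◅ ε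
load-head true false xs = (fzero , (λ ()) , refl) ◅ ε
load-head true true xs = ε

flush : ∀ {k} a (xs : Vec Bool k) → Reach (shiftIn a) xs (replicate k a)
flush a [] = ε
flush a (x ∷ xs) = load-head a x xs ◅◅ extend (flush a xs)

shift : ∀ {k} a (xs : Vec Bool k) → Reach (shiftIn a) xs (shiftIn a xs)
shift a [] = ε
shift a (x ∷ xs) = extend (shift x xs) ◅◅ load-head a x (shiftIn x xs)

changesFrom-nonincreasing : ∀ {k} a {xs ys : Vec Bool k} → Trans (shiftIn a) xs ys → changesFrom a ys ≤ changesFrom a xs
changesFrom-nonincreasing false {true ∷ xs} (fzero , _ , refl) = changesFrom-≤-suc false true xs
changesFrom-nonincreasing true {false ∷ xs} (fzero , _ , refl) = changesFrom-≤-suc true false xs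
changesFrom-nonincreasing false {false ∷ xs} (fzero , moves , refl) = ⊥-elim (moves refl)
changesFrom-nonincreasing true {true ∷ xs} (fzero , moves , refl) = ⊥-elim (moves refl)
changesFrom-nonincreasing a {x ∷ xs} (fsuc i , moves , refl) =
  +-monoʳ-≤ (differ a x) (changesFrom-nonincreasing x {xs} (i , moves , refl))

advance : ∀ {k} a j → Reach (shiftIn a) (zigzag {suc k} a (suc j)) (a ∷ zigzag a (suc j))
advance a j = extend (subst (Reach (shiftIn (not a)) _) (shiftIn-zigzag a j) (shift (not a) _)) ◅◅ load-head a (not a) _

spread : ∀ {k} a (w : Vec Bool k) → Reach (shiftIn a) (zigzag a (changesFrom a w)) w
spread-repeat : ∀ {k} a (w : Vec Bool k) → Reach (shiftIn a) (zigzag a (changesFrom a w)) (a ∷ w)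

spread a [] = ε
spread false (false ∷ w) = spread-repeat false w
spread false (true ∷ w) = extend (spread true w)
spread true (false ∷ w) = extend (spread false w)
spread true (true ∷ w) = spread-repeat true w

spread-repeat a w with changesFrom a w | spread a w
... | zero | r = extend r
... | suc j | r = advance a j ◅◅ extend r

-- The network

tailChanges : ∀ L {n} → Vec Bool (L + n) → ℕ
tailChanges L cs = changes (drop L cs)

network : (L M : ℕ) → BN (suc (suc (L + suc M)))
network L M (e ∷ u ∷ cs) =
  (e ∨ does (tailChanges L cs ≟ M)) ∷
  (if not e ∧ does (tailChanges L cs ≟ 0) then not u else u) ∷
  shiftIn u cs

module Dynamics (L M : ℕ) where

  F : BN (suc (suc (L + suc M)))
  F = network L M

  register-run : ∀ e u {cs cs′} → Reach (shiftIn u) cs cs′ → Reach F (e ∷ u ∷ cs) (e ∷ u ∷ cs′)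
  register-run e u = gmap (λ v → e ∷ u ∷ v) λ (i , moves , eq) → fsuc (fsuc i) , moves , cong (λ v → e ∷ u ∷ v) eq

  settle : ∀ e u cs → Reach F (e ∷ u ∷ cs) (e ∷ u ∷ replicate _ u)
  settle e u cs = register-run e u (flush u cs)

  toggle : ∀ a cs → tailChanges L cs ≡ 0 → Trans F (false ∷ not a ∷ cs) (false ∷ a ∷ cs)
  toggle a cs quiet = fsuc fzero , moves , cong (λ b → false ∷ b ∷ cs) (sym (not-involutive a))
    where
    moves : (if does (tailChanges L cs ≟ 0) then not (not a) else not a) ≢ not a
    moves rewrite quiet = not-¬ refl ∘ sym

  fire : ∀ u cs → tailChanges L cs ≡ M → Trans F (false ∷ u ∷ cs) (true ∷ u ∷ cs)
  fire u cs full = fzero , moves , refl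
    where
    moves : does (tailChanges L cs ≟ M) ≢ false
    moves rewrite dec-true (tailChanges L cs ≟ M) full = λ ()

  latched-fixed : ∀ u → FixedPoint F (true ∷ u ∷ replicate _ u)
  latched-fixed u y (fzero , moves , _) = moves refl
  latched-fixed u y (fsuc fzero , moves , _) = moves refl
  latched-fixed u y (fsuc (fsuc i) , moves , _) = moves (cong (λ v → lookup v i) (shiftIn-replicate u))

  private
    toggle-resting : ∀ a → Reach F (false ∷ not a ∷ replicate _ (not a)) (false ∷ a ∷ replicate _ a)
    toggle-resting a = toggle a _ (changes-drop-zigzag L (not a) z≤n) ◅ settle false a _

  resting-connected : ∀ u a → Reach F (false ∷ u ∷ replicate _ u) (false ∷ a ∷ replicate _ a)
  resting-connected false false = ε
  resting-connected false true = toggle-resting true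
  resting-connected true false = toggle-resting false
  resting-connected true true = ε

  reach-zigzag : ∀ u cs a {k} → k ≤ suc L → Reach F (false ∷ u ∷ cs) (false ∷ a ∷ zigzag a k)
  reach-zigzag u cs a {zero} _ = settle false u cs ◅◅ resting-connected u a
  reach-zigzag u cs a {suc k} k<1+L =
    reach-zigzag u cs (not a) (≤-trans (n≤1+n k) k<1+L) ◅◅ shifted ◅◅ toggle a _ (changes-drop-zigzag L a k<1+L) ◅ ε
    where
    shifted : Reach F (false ∷ not a ∷ zigzag (not a) k) (false ∷ not a ∷ zigzag a (suc k))
    shifted = subst (λ v → Reach F (false ∷ not a ∷ zigzag (not a) k) (false ∷ not a ∷ v))
                    (shiftIn-zigzag a k) (register-run false (not a) (shift (not a) _))

module _ (L : ℕ) where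
  open Dynamics L (suc L)

  private
    primed : Vec Bool (L + suc (suc L))
    primed = replicate L true ++ true ∷ zigzag true (suc L)

    primed-changes : changesFrom true primed ≡ suc L
    primed-changes = trans (changesFrom-replicate-++ L true _) (changesFrom-zigzag (suc L) true)

    primed-tail : tailChanges L primed ≡ suc L
    primed-tail = trans (cong changes (drop-++ (replicate L true) _)) (changesFrom-zigzag (suc L) true)

    prime : Reach (shiftIn true) (zigzag true (suc L)) primed
    prime = subst (λ k → Reach (shiftIn true) (zigzag true k) primed) primed-changes (spread true primed)

    escape : ∀ x → ∃ λ z → FixedPoint F z × Reach F x z
    escape (true ∷ u ∷ cs) = _ , latched-fixed u , settle true u cs
    escape (false ∷ u ∷ cs) = _ , latched-fixed true ,
      reach-zigzag u cs true ≤-refl ◅◅ register-run false true prime ◅◅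
      fire true primed primed-tail ◅ settle true true primed

  network-acyclic : NumCyclicAttractors (network L (suc L)) 0
  network-acyclic = no-cyclic-attractor F escape

module _ (L : ℕ) where
  open Dynamics L (suc (suc L))

  private
    Cycle : StateSet (suc (suc (L + suc (suc (suc L)))))
    Cycle (e ∷ u ∷ cs) = not e ∧ does (changesFrom u cs ≤? suc L)

    Cycle-intro : ∀ u cs → changesFrom u cs ≤ suc L → Cycle (false ∷ u ∷ cs) ≡ true
    Cycle-intro u cs = dec-true (changesFrom u cs ≤? suc L)

    Cycle-bound : ∀ u cs → Cycle (false ∷ u ∷ cs) ≡ true → changesFrom u cs ≤ suc L
    Cycle-bound u cs = does≡true⇒ (changesFrom u cs ≤? suc L)

    Cycle-trap : TrapSet F Cycle
    Cycle-trap (true ∷ _ ∷ _) _ () _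
    Cycle-trap (false ∷ u ∷ cs) _ inside (fzero , moves , refl) = ⊥-elim (moves (dec-false (_ ≟ _) not-full))
      where
      not-full : tailChanges L cs ≢ suc (suc L)
      not-full full = 1+n≰n (≤-trans (≤-reflexive (sym full))
                                     (≤-trans (changes-drop≤changesFrom L u cs) (Cycle-bound u cs inside)))
    Cycle-trap (false ∷ u ∷ cs) _ inside (fsuc fzero , moves , refl) =
      Cycle-intro (not u) cs (changesFrom≤1+prefix L (not u) cs quiet)
      where
      quiet : tailChanges L cs ≡ 0
      quiet = decidable-stable (_ ≟ 0) λ noisy →
        moves (cong (λ b → if b then not u else u) (dec-false (_ ≟ 0) noisy))
    Cycle-trap (false ∷ u ∷ cs) _ inside (fsuc (fsuc i) , moves , refl) =
      Cycle-intro u (flipAt cs i)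
        (≤-trans (changesFrom-nonincreasing u {cs} (i , moves , refl)) (Cycle-bound u cs inside))

    resting-in-Cycle : ∀ u → Cycle (false ∷ u ∷ replicate _ u) ≡ true
    resting-in-Cycle u =
      Cycle-intro u (replicate _ u) (≤-trans (≤-reflexive (changesFrom-replicate {L + suc (suc (suc L))} u)) z≤n)

    Cycle-connected : ∀ {x y} → Cycle x ≡ true → Cycle y ≡ true → Reach F x y
    Cycle-connected {true ∷ _ ∷ _} ()
    Cycle-connected {_} {true ∷ _ ∷ _} _ ()
    Cycle-connected {false ∷ u ∷ cs} {false ∷ a ∷ w} _ inside =
      reach-zigzag u cs a (Cycle-bound a w inside) ◅◅ register-run false a (spread a w)

    settle-or-cycle : ∀ x → (∃ λ z → FixedPoint F z × Reach F x z) ⊎ (∃ λ c → Cycle c ≡ true × Reach F x c)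
    settle-or-cycle (true ∷ u ∷ cs) = inj₁ (_ , latched-fixed u , settle true u cs)
    settle-or-cycle (false ∷ u ∷ cs) = inj₂ (_ , resting-in-Cycle u , settle false u cs)

  network-oscillates : NumCyclicAttractors (network L (suc (suc L))) 1
  network-oscillates =
    unique-cyclic-attractor F Cycle Cycle-trap
      (false ∷ false ∷ replicate _ false , false ∷ true ∷ replicate _ true , (λ ()) ,
       resting-in-Cycle false , resting-in-Cycle true)
      Cycle-connected settle-or-cycle

-- Interaction graph of the network and elimination of prefix cells

cell : ∀ {k} → Fin k → Fin (suc (suc k))
cell i = fsuc (fsuc i)

module Graph (L M : ℕ) where

  F : BN (suc (suc (L + suc M)))
  F = network L M

  cell-copies : ∀ i x → comp F (cell i) x ≡ lookup x (fsuc (inject₁ i))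
  cell-copies i (e ∷ u ∷ cs) = lookup-shiftIn u cs i

  cell-InDegreeOne : ∀ i → InDegreeOne F (cell i)
  cell-InDegreeOne i = copy⇒InDegreeOne F (cell-copies i)

  cell-NoPositiveLoop : ∀ i → NoPositiveLoop F (cell i)
  cell-NoPositiveLoop i loop = suc≢inject₁ i (suc-injective (proj₁ (copy⇒Edge-unique F (cell-copies i) loop)))

  prefix-OutDegreeOne : ∀ k → OutDegreeOne F (cell (k ↑ˡ suc M))
  prefix-OutDegreeOne k = cell (next k) , plus , copy⇒Edge F successor-copies , unique
    where
    successor-copies : ∀ x → comp F (cell (next k)) x ≡ lookup x (cell (k ↑ˡ suc M))
    successor-copies x = trans (cell-copies (next k) x) (cong (lookup x ∘ fsuc) (inject₁-next k))

    latch-ignores : ∀ x → comp F fzero (flipAt x (cell (k ↑ˡ suc M))) ≡ comp F fzero x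
    latch-ignores (e ∷ u ∷ cs) = cong (λ v → e ∨ does (changes v ≟ M)) (drop-updateAt-↑ˡ L k cs)

    oscillator-ignores : ∀ x → comp F (fsuc fzero) (flipAt x (cell (k ↑ˡ suc M))) ≡ comp F (fsuc fzero) x
    oscillator-ignores (e ∷ u ∷ cs) =
      cong (λ v → if not e ∧ does (changes v ≟ 0) then not u else u) (drop-updateAt-↑ˡ L k cs)

    unique : ∀ i s → Edge F (cell (k ↑ˡ suc M)) i s → i ≡ cell (next k) × s ≡ plus
    unique fzero s edge = ⊥-elim (independent⇒¬Edge F latch-ignores s edge)
    unique (fsuc fzero) s edge = ⊥-elim (independent⇒¬Edge F oscillator-ignores s edge)
    unique (fsuc (fsuc i)) s edge with copy⇒Edge-unique F (cell-copies i) edge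
    ... | same-regulator , s≡plus =
      cong cell (inject₁-injective (trans (sym (suc-injective same-regulator)) (sym (inject₁-next k)))) , s≡plus

prefix-IsPath : ∀ n M → IsPath (network (suc n) M) n (λ k → cell (k ↑ˡ suc M))
prefix-IsPath n M = (λ k → plus , step k) , λ k l eq → ↑ˡ-injective (suc M) k l (suc-injective (suc-injective eq))
  where
  open Graph (suc n) M

  step : ∀ k → Edge F (cell (inject₁ k ↑ˡ suc M)) (cell (fsuc k ↑ˡ suc M)) plus
  step k = subst (λ j → Edge F (fsuc (fsuc j)) (cell (fsuc k ↑ˡ suc M)) plus)
                 (inject₁-↑ˡ (suc M) k) (copy⇒Edge F (cell-copies (fsuc k ↑ˡ suc M)))

eliminate-prefix-cell : ∀ L M k → eliminate (network (suc L) M) (cell (k ↑ˡ suc M)) ≗ network L M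
eliminate-prefix-cell L M k y = trans (eliminate≗substitute F (cell q) self-independent y) (substitution y)
  where
  F : BN (suc (suc (suc L + suc M)))
  F = network (suc L) M

  q : Fin (suc L + suc M)
  q = k ↑ˡ suc M

  self-independent : ∀ y a → comp F (cell q) (insertAt y (cell q) a) ≡ comp F (cell q) (insertAt y (cell q) false)
  self-independent (e ∷ u ∷ cs) a =
    trans (lookup-shiftIn-insertAt u cs q a) (sym (lookup-shiftIn-insertAt u cs q false))

  component : ∀ y i → comp F (punchIn (cell q) i) (liftS F (cell q) false y) ≡ comp (network L M) i y
  component (e ∷ u ∷ cs) fzero = cong (λ v → e ∨ does (changes v ≟ M)) (drop-insertAt-↑ˡ L k cs _)
  component (e ∷ u ∷ cs) (fsuc fzero) =
    cong (λ v → if not e ∧ does (changes v ≟ 0) then not u else u) (drop-insertAt-↑ˡ L k cs _)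
  component (e ∷ u ∷ cs) (fsuc (fsuc i)) =
    trans (cong (λ c → lookup (shiftIn u (insertAt cs q c)) (punchIn q i)) (lookup-shiftIn-insertAt u cs q false))
          (lookup-shiftIn-insertAt-punchIn u cs q i)

  substitution : substitute F (cell q) ≗ network L M
  substitution y = trans (tabulate-cong (component y)) (tabulate∘lookup (network L M y))

theorem4p3 : (n : ℕ) → 1 ≤ n →
    Σ ℕ λ m → Σ (BN (suc m)) λ f → Σ (Fin (suc n) → Fin (suc m)) λ p →
      IsPath f n p ×
      (∀ k → InDegreeOne f (p k) × OutDegreeOne f (p k)) ×
      (∀ k → NoPositiveLoop f (p k) ×
        (∃₂ λ a b → NumCyclicAttractors f a ×
          NumCyclicAttractors (eliminate f (p k)) b × a < b))
theorem4p3 n _ =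
  _ , network (suc n) M , (λ k → cell (k ↑ˡ suc M)) ,
  prefix-IsPath n M ,
  (λ k → cell-InDegreeOne _ , prefix-OutDegreeOne k) ,
  λ k → cell-NoPositiveLoop _ ,
        0 , 1 , network-acyclic (suc n) ,
        NumCyclicAttractors-resp-≗ (sym ∘ eliminate-prefix-cell n M k) (network-oscillates n) ,
        s≤s z≤n
  where
  M : ℕ
  M = suc (suc n)

  open Graph (suc n) M
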